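{- Let $b,c,w_2$ be rational numbers such that $F(b,c)\neq 0$ and $Q_2(b,c)\neq 0$, such that $(b,c,w_2)$ lies on the surface $$D_2\,(w_2^2+3)^3+4\,(w_2-1)^2\,(1+w_2)^2=0,\qquad D_2=-\frac{P_2^2}{Q_2^3},$$ and such that $w_2\neq\pm 1$. Then there exists a rational number $\alpha_2$ such that $$w_2^2+3=Q_2\,\alpha_2^2,\qquad 2\,(w_2^2-1)=P_2\,\alpha_2^3 .$$
   Context: Define $F=b^2c^4-6b^2c^3+13b^2c^2-12b^2c+4b^2+c^2$, $$Q_2=\tfrac{3}{2}\,(6b^4c^4-36b^4c^3+78b^4c^2-72b^4c+24b^4-12b^3c^4+36b^3c^3-72b^3c+48b^3+5b^2c^4+16b^2c^3-68b^2c^2+32b^2c+20b^2-12bc^3+24bc+6c^2),$$ and $P_2=\dfrac{b\,N_2}{2F}$, where $N_2=832b^2c^2-1440b^2c^4-840b^2c^3+4788b^3c^4+396bc^3+720b^3c+808b^4c^4+3032b^4c^3-2576b^4c^2-96b^4c+448b^4-504bc^4-4176b^3c^3-9b^3c^8+72b^3c^2-720b^2c^6+2288b^2c^5+1044b^3c^7-322b^4c^8+758b^4c^7+404b^4c^6-210b^2c^7-2464b^4c^5-2394b^3c^6+72c^4+252bc^6+3168b^6c^8+441b^5c^9-7056b^5c+57960b^6c^4-47232b^6c^3+25344b^6c^2-8064b^6c-1809b^5c^8+14472b^5c^2+3951b^5c^7-72c^5+36c^6-11808b^6c^7+1440b^5+28980b^6c^6-49032b^6c^5-4410b^5c^6+8820b^5c^4-15804b^5c^3+1152b^6-504b^6c^9-45b^3c^9-6b^4c^9+104b^2c^8+36b^6c^{10}+14b^4c^{10}-45b^5c^{10}-99bc^7$.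 These quantities arise in the study of rational perfect cuboids: the surface above parametrizes (via $b,c,w_2$) rational solutions of the cuboid factor equations. -}

module Defs where

open import Data.Nat using (ℕ; zero; suc)
open import Data.Integer using (+_)
open import Data.Rational using (ℚ; 0ℚ; 1ℚ; _+_; _-_; _*_; -_; _/_; _÷_; NonZero; ≢-nonZero)
open import Relation.Binary.PropositionalEquality using (_≢_)

q : ℕ → ℚ
q n = (+ n) / 1

infixr 8 _^_
_^_ : ℚ → ℕ → ℚ
x ^ zero = 1ℚ
x ^ suc n = x * (x ^ n)

F : ℚ → ℚ → ℚ
F b c =
  q 1 * (b ^ 2) * (c ^ 4) - q 6 * (b ^ 2) * (c ^ 3) + q 13 * (b ^ 2) * (c ^ 2) - q 12 * (b ^ 2) * c + q 4 * (b ^ 2) + q 1 * (c ^ 2)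

Q2poly : ℚ → ℚ → ℚ
Q2poly b c =
  q 6 * (b ^ 4) * (c ^ 4) - q 36 * (b ^ 4) * (c ^ 3) + q 78 * (b ^ 4) * (c ^ 2) - q 72 * (b ^ 4) * c + q 24 * (b ^ 4) - q 12 * (b ^ 3) * (c ^ 4) + q 36 * (b ^ 3) * (c ^ 3) - q 72 * (b ^ 3) * c + q 48 * (b ^ 3) + q 5 * (b ^ 2) * (c ^ 4) + q 16 * (b ^ 2) * (c ^ 3) - q 68 * (b ^ 2) * (c ^ 2) + q 32 * (b ^ 2) * c + q 20 * (b ^ 2) - q 12 * b * (c ^ 3) + q 24 * b * c + q 6 * (c ^ 2)

N2 : ℚ → ℚ → ℚ
N2 b c =
  q 832 * (b ^ 2) * (c ^ 2) - q 1440 * (b ^ 2) * (c ^ 4) - q 840 * (b ^ 2) * (c ^ 3) + q 4788 * (b ^ 3) * (c ^ 4) + q 396 * b * (c ^ 3) + q 720 * (b ^ 3) * c + q 808 * (b ^ 4) * (c ^ 4) + q 3032 * (b ^ 4) * (c ^ 3) - q 2576 * (b ^ 4) * (c ^ 2) - q 96 * (b ^ 4) * c + q 448 * (b ^ 4) - q 504 * b * (c ^ 4) - q 4176 * (b ^ 3) * (c ^ 3) - q 9 * (b ^ 3) * (c ^ 8) + q 72 * (b ^ 3) * (c ^ 2) - q 720 * (b ^ 2) * (c ^ 6) + q 2288 * (b ^ 2) * (c ^ 5) + q 1044 * (b ^ 3) * (c ^ 7) - q 322 * (b ^ 4) * (c ^ 8) + q 758 * (b ^ 4) * (c ^ 7)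 + q 404 * (b ^ 4) * (c ^ 6) - q 210 * (b ^ 2) * (c ^ 7) - q 2464 * (b ^ 4) * (c ^ 5) - q 2394 * (b ^ 3) * (c ^ 6) + q 72 * (c ^ 4) + q 252 * b * (c ^ 6) + q 3168 * (b ^ 6) * (c ^ 8) + q 441 * (b ^ 5) * (c ^ 9) - q 7056 * (b ^ 5) * c + q 57960 * (b ^ 6) * (c ^ 4) - q 47232 * (b ^ 6) * (c ^ 3) + q 25344 * (b ^ 6) * (c ^ 2) - q 8064 * (b ^ 6) * c - q 1809 * (b ^ 5) * (c ^ 8) + q 14472 * (b ^ 5) * (c ^ 2) + q 3951 * (b ^ 5) * (c ^ 7) - q 72 * (c ^ 5) + q 36 * (c ^ 6) - q 11808 * (b ^ 6) * (c ^ 7) + q 1440 * (b ^ 5) + q 28980 * (b ^ 6) * (c ^ 6) - q 49032 * (b ^ 6) * (c ^ 5) - q 4410 * (b ^ 5) * (c ^ 6) + q 8820 * (b ^ 5) * (c ^ 4) - q 15804 * (b ^ 5) * (c ^ 3) + q 1152 * (b ^ 6) - q 504 * (b ^ 6) * (c ^ 9) - q 45 * (b ^ 3) * (c ^ 9) - q 6 * (b ^ 4) * (c ^ 9) + q 104 * (b ^ 2) * (c ^ 8) + q 36 * (b ^ 6) * (c ^ 10) + q 14 * (b ^ 4) * (c ^ 10) - q 45 * (b ^ 5) * (c ^ 10) - q 99 * b * (c ^ 7)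

Q2 : ℚ → ℚ → ℚ
Q2 b c = ((+ 3) / 2) * Q2poly b c

P2 : (b c : ℚ) → F b c ≢ 0ℚ → ℚ
P2 b c hF = ((b * N2 b c) ÷ q 2) ÷ F b c
  where instance
    nz : NonZero (F b c)
    nz = ≢-nonZero hF

D2 : (b c : ℚ) → F b c ≢ 0ℚ → Q2 b c ≢ 0ℚ → ℚ
D2 b c hF hQ = - ((((P2 b c hF) ^ 2) ÷ Q2 b c) ÷ Q2 b c ÷ Q2 b c)
  where instance
    nz : NonZero (Q2 b c)
    nz = ≢-nonZero hQ

module Submission where

-- Write P = P₂, Q = Q₂, W = w₂² + 3 and E = 2(w₂² − 1).  Since 4(w₂−1)²(1+w₂)² = E²
-- and D₂ = −P²/Q³, multiplying the surface equation by Q³ turns it into the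
-- cubic relation
--        P² W³ = E² Q³.
-- Over ℚ such a relation with Q ≠ 0 and E ≠ 0 forces P W ≠ 0, and then
-- α = E Q / (P W) is a common "square–cube root": from (Q α²)(P W)² = Q (E Q)² = P² W³
-- we get W = Q α², and then (P α³) Q = (Q α²)(P α) = α (P W) = E Q gives E = P α³.
-- The hypothesis w₂ ≠ ±1 is exactly what makes E non-zero.

open import Defs
open import Data.Maybe.Base using (Maybe; nothing; just)
open import Data.Product using (Σ; _×_; _,_)
open import Data.Rational using (ℚ; 0ℚ; 1ℚ; _+_; _-_; _*_; -_; 1/_; _÷_; NonZero; ≢-nonZero)
open import Data.Rational.Properties
  using (_≟_; +-*-commutativeRing; +-0-group; *-assoc; *-identityʳ; *-inverseˡ; *-inverseʳ; *-zeroˡ)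
open import Algebra.Properties.Group +-0-group using (x∙y⁻¹≈ε⇒x≈y)
open import Level using (0ℓ)
open import Relation.Nullary using (yes; no)
open import Relation.Binary.PropositionalEquality using (_≡_; _≢_; refl; sym; trans; cong)
open import Tactic.RingSolver using (solve-∀)
import Tactic.RingSolver.Core.AlmostCommutativeRing as ACR
open Relation.Binary.PropositionalEquality.≡-Reasoning

ℚ-ring : ACR.AlmostCommutativeRing 0ℓ 0ℓ
ℚ-ring = ACR.fromCommutativeRing +-*-commutativeRing isZero
  where
  isZero : (x : ℚ) → Maybe (0ℚ ≡ x)
  isZero x with x ≟ 0ℚ
  ... | yes x≡0 = just (sym x≡0)
  ... | no  _   = nothing

*-/-cancel : (x a : ℚ) .{{_ : NonZero a}} → x * a * (1/ a) ≡ x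
*-/-cancel x a = begin
  x * a * (1/ a)   ≡⟨ *-assoc x a (1/ a) ⟩
  x * (a * (1/ a)) ≡⟨ cong (x *_) (*-inverseʳ a) ⟩
  x * 1ℚ           ≡⟨ *-identityʳ x ⟩
  x                ∎

/-*-cancel : (x a : ℚ) .{{_ : NonZero a}} → x * (1/ a) * a ≡ x
/-*-cancel x a = begin
  x * (1/ a) * a   ≡⟨ *-assoc x (1/ a) a ⟩
  x * ((1/ a) * a) ≡⟨ cong (x *_) (*-inverseˡ a) ⟩
  x * 1ℚ           ≡⟨ *-identityʳ x ⟩
  x                ∎

*-cancelʳ-≢0 : {x y a : ℚ} → a ≢ 0ℚ → x * a ≡ y * a → x ≡ y
*-cancelʳ-≢0 {x} {y} {a} a≢0 xa≡ya = begin
  x              ≡⟨ sym (*-/-cancel x a) ⟩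
  x * a * (1/ a) ≡⟨ cong (_* (1/ a)) xa≡ya ⟩
  y * a * (1/ a) ≡⟨ *-/-cancel y a ⟩
  y              ∎
  where instance _ = ≢-nonZero a≢0

*-≢0 : {a b : ℚ} → a ≢ 0ℚ → b ≢ 0ℚ → a * b ≢ 0ℚ
*-≢0 {a} {b} a≢0 b≢0 ab≡0 = a≢0 (*-cancelʳ-≢0 b≢0 (trans ab≡0 (sym (*-zeroˡ b))))

square-cube-descent : (P Q W E : ℚ) → Q ≢ 0ℚ → E ≢ 0ℚ
  → P * P * (W * W * W) ≡ E * E * (Q * Q * Q)
  → Σ ℚ (λ α → (W ≡ Q * α ^ 2) × (E ≡ P * α ^ 3))
square-cube-descent P Q W E Q≢0 E≢0 cubic = α , W≡Qα² , E≡Pα³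
  where
  -- P W ≠ 0, since otherwise the left side of the cubic relation vanishes
  PW≢0 : P * W ≢ 0ℚ
  PW≢0 PW≡0 = *-≢0 (*-≢0 E≢0 E≢0) (*-≢0 (*-≢0 Q≢0 Q≢0) Q≢0) (begin
    E * E * (Q * Q * Q)       ≡⟨ sym cubic ⟩
    P * P * (W * W * W)       ≡⟨ regroup P W ⟩
    P * W * (P * W * W)       ≡⟨ cong (_* (P * W * W)) PW≡0 ⟩
    0ℚ * (P * W * W)          ≡⟨ *-zeroˡ (P * W * W) ⟩
    0ℚ                        ∎)
    where
    regroup : ∀ (P W : ℚ) → P * P * (W * W * W) ≡ P * W * (P * W * W)
    regroup = solve-∀ ℚ-ring

  instance _ = ≢-nonZero PW≢0

  α : ℚ
  α = E * Q * (1/ (P * W))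

  αPW≡EQ : α * (P * W) ≡ E * Q
  αPW≡EQ = /-*-cancel (E * Q) (P * W)

  Qα²≡W : Q * (α * (α * 1ℚ)) ≡ W
  Qα²≡W = *-cancelʳ-≢0 (*-≢0 PW≢0 PW≢0) (begin
    Q * (α * (α * 1ℚ)) * (P * W * (P * W)) ≡⟨ square α (P * W) Q ⟩
    Q * (α * (P * W)) * (α * (P * W))      ≡⟨ cong (λ z → Q * z * z) αPW≡EQ ⟩
    Q * (E * Q) * (E * Q)                  ≡⟨ cube E Q ⟩
    E * E * (Q * Q * Q)                    ≡⟨ sym cubic ⟩
    P * P * (W * W * W)                    ≡⟨ regroup P W ⟩
    W * (P * W * (P * W))                  ∎)
    where
    square : ∀ (α v Q : ℚ) → Q * (α * (α * 1ℚ)) * (v * v) ≡ Q * (α * v) * (α * v)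
    square = solve-∀ ℚ-ring
    cube : ∀ (E Q : ℚ) → Q * (E * Q) * (E * Q) ≡ E * E * (Q * Q * Q)
    cube = solve-∀ ℚ-ring
    regroup : ∀ (P W : ℚ) → P * P * (W * W * W) ≡ W * (P * W * (P * W))
    regroup = solve-∀ ℚ-ring

  W≡Qα² : W ≡ Q * α ^ 2
  W≡Qα² = sym Qα²≡W

  E≡Pα³ : E ≡ P * α ^ 3
  E≡Pα³ = sym (*-cancelʳ-≢0 Q≢0 (begin
    P * (α * (α * (α * 1ℚ))) * Q ≡⟨ split P α Q ⟩
    Q * (α * (α * 1ℚ)) * (P * α) ≡⟨ cong (_* (P * α)) Qα²≡W ⟩
    W * (P * α)                  ≡⟨ swap W P α ⟩
    α * (P * W)                  ≡⟨ αPW≡EQ ⟩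
    E * Q                        ∎))
    where
    split : ∀ (P α Q : ℚ) → P * (α * (α * (α * 1ℚ))) * Q ≡ Q * (α * (α * 1ℚ)) * (P * α)
    split = solve-∀ ℚ-ring
    swap : ∀ (W P α : ℚ) → W * (P * α) ≡ α * (P * W)
    swap = solve-∀ ℚ-ring

E-≢0 : (w : ℚ) → w ≢ 1ℚ → w ≢ - 1ℚ → q 2 * (w ^ 2 - 1ℚ) ≢ 0ℚ
E-≢0 w w≢1 w≢-1 E≡0 =
  *-≢0 (*-≢0 2≢0 (≢⇒-≢0 w≢1)) (≢⇒-≢0 w≢-1) (trans (sym (factor (q 2) w)) E≡0)
  where
  2≢0 : q 2 ≢ 0ℚ
  2≢0 ()
  ≢⇒-≢0 : {x y : ℚ} → x ≢ y → x - y ≢ 0ℚ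
  ≢⇒-≢0 {x} {y} x≢y x-y≡0 = x≢y (x∙y⁻¹≈ε⇒x≈y x y x-y≡0)
  factor : ∀ (t w : ℚ) → t * (w * (w * 1ℚ) - 1ℚ) ≡ t * (w - 1ℚ) * (w - - 1ℚ)
  factor = solve-∀ ℚ-ring

÷³-cancel : (x a : ℚ) .{{_ : NonZero a}} → x ÷ a ÷ a ÷ a * (a * a * a) ≡ x
÷³-cancel x a = begin
  x * (1/ a) * (1/ a) * (1/ a) * (a * a * a) ≡⟨ regroup x a (1/ a) ⟩
  x * (a * (1/ a) * (a * (1/ a)) * (a * (1/ a))) ≡⟨ cong (λ u → x * (u * u * u)) (*-inverseʳ a) ⟩
  x * (1ℚ * 1ℚ * 1ℚ)                         ≡⟨ unit x ⟩
  x                                          ∎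
  where
  regroup : ∀ (x a i : ℚ) → x * i * i * i * (a * a * a) ≡ x * (a * i * (a * i) * (a * i))
  regroup = solve-∀ ℚ-ring
  unit : ∀ (x : ℚ) → x * (1ℚ * 1ℚ * 1ℚ) ≡ x
  unit = solve-∀ ℚ-ring

D2-cleared : (b c : ℚ) (hF : F b c ≢ 0ℚ) (hQ : Q2 b c ≢ 0ℚ)
  → - (D2 b c hF hQ * (Q2 b c * Q2 b c * Q2 b c)) ≡ P2 b c hF ^ 2
D2-cleared b c hF hQ =
  trans (neg-neg (P2 b c hF ^ 2 ÷ Q2 b c ÷ Q2 b c ÷ Q2 b c) (Q2 b c * Q2 b c * Q2 b c))
        (÷³-cancel (P2 b c hF ^ 2) (Q2 b c))
  where
  instance _ = ≢-nonZero hQ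
  neg-neg : ∀ (y z : ℚ) → - (- y * z) ≡ y * z
  neg-neg = solve-∀ ℚ-ring

cubic-relation : (D P Q W w : ℚ) → - (D * (Q * Q * Q)) ≡ P ^ 2
  → D * W ^ 3 + q 4 * (w - 1ℚ) ^ 2 * (1ℚ + w) ^ 2 ≡ 0ℚ
  → P * P * (W * W * W) ≡ q 2 * (w ^ 2 - 1ℚ) * (q 2 * (w ^ 2 - 1ℚ)) * (Q * Q * Q)
cubic-relation D P Q W w −DQ³≡P² surface = begin
  P * P * (W * W * W)               ≡⟨ cong (_* (W * W * W)) (trans (square P) (sym −DQ³≡P²)) ⟩
  - (D * Q³) * (W * W * W)          ≡⟨ expand D Q W (q 2) w ⟩
  Q³ * K - Q³ * (D * W ^ 3 + K)     ≡⟨ cong (λ s → Q³ * K - Q³ * s) surface ⟩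
  Q³ * K - Q³ * 0ℚ                  ≡⟨ collect Q (q 2) w ⟩
  q 2 * (w ^ 2 - 1ℚ) * (q 2 * (w ^ 2 - 1ℚ)) * Q³ ∎
  where
  Q³ = Q * Q * Q
  K = q 2 * q 2 * ((w - 1ℚ) * ((w - 1ℚ) * 1ℚ)) * ((1ℚ + w) * ((1ℚ + w) * 1ℚ))
  square : ∀ (P : ℚ) → P * P ≡ P * (P * 1ℚ)
  square = solve-∀ ℚ-ring
  expand : ∀ (D Q W t w : ℚ) → - (D * (Q * Q * Q)) * (W * W * W)
    ≡ Q * Q * Q * (t * t * ((w - 1ℚ) * ((w - 1ℚ) * 1ℚ)) * ((1ℚ + w) * ((1ℚ + w) * 1ℚ)))
      - Q * Q * Q * (D * (W * (W * (W * 1ℚ)))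
        + t * t * ((w - 1ℚ) * ((w - 1ℚ) * 1ℚ)) * ((1ℚ + w) * ((1ℚ + w) * 1ℚ)))
  expand = solve-∀ ℚ-ring
  collect : ∀ (Q t w : ℚ)
    → Q * Q * Q * (t * t * ((w - 1ℚ) * ((w - 1ℚ) * 1ℚ)) * ((1ℚ + w) * ((1ℚ + w) * 1ℚ)))
      - Q * Q * Q * 0ℚ
    ≡ t * (w * (w * 1ℚ) - 1ℚ) * (t * (w * (w * 1ℚ) - 1ℚ)) * (Q * Q * Q)
  collect = solve-∀ ℚ-ring

theorem2p2 : (b c w₂ : ℚ) → (hF : F b c ≢ 0ℚ) → (hQ : Q2 b c ≢ 0ℚ)
    → D2 b c hF hQ * (w₂ ^ 2 + q 3) ^ 3 + q 4 * (w₂ - 1ℚ) ^ 2 * (1ℚ + w₂) ^ 2 ≡ 0ℚ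
    → w₂ ≢ 1ℚ → w₂ ≢ - 1ℚ
    → Σ ℚ (λ α₂ → (w₂ ^ 2 + q 3 ≡ Q2 b c * α₂ ^ 2)
    × (q 2 * (w₂ ^ 2 - 1ℚ) ≡ P2 b c hF * α₂ ^ 3))
theorem2p2 b c w₂ hF hQ surface w₂≢1 w₂≢-1 =
  square-cube-descent (P2 b c hF) (Q2 b c) (w₂ ^ 2 + q 3) (q 2 * (w₂ ^ 2 - 1ℚ))
    hQ (E-≢0 w₂ w₂≢1 w₂≢-1)
    (cubic-relation (D2 b c hF hQ) (P2 b c hF) (Q2 b c) (w₂ ^ 2 + q 3) w₂
      (D2-cleared b c hF hQ) surface)
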